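{- If $Q$ is a finite (left) quasifield with $q$ elements and $A,B,C,D\subset Q$ with $|A||B||C||D| > q^3$, then \[ Q = A + B + C\cdot D. \]
   Context: A (left) quasifield is a set $Q$ with two binary operations $+$ and $\cdot$ such that $(Q,+)$ is a group with identity $0$; $(Q\setminus\{0\},\cdot)$ is a loop (for all $a,b$ the equations $a\cdot x=b$ and $y\cdot a=b$ have unique solutions, and there is an identity $1$); $a\cdot(b+c)=a\cdot b+a\cdot c$ for all $a,b,c$; $0\cdot x=0$ for all $x$; and for $a\neq b$ the equation $a\cdot x=b\cdot x+c$ has exactly one solution $x$. $A+B+C\cdot D=\{a+b+c\cdot d: a\in A,b\in B,c\in C,d\in D\}$. -}

module Defs where

open import Level using (0ℓ)
open import Data.Nat using (ℕ)
open import Data.Fin using (Fin)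
open import Data.Product using (∃!; _×_)
open import Relation.Binary.PropositionalEquality using (_≡_)
open import Relation.Nullary using (¬_)
open import Algebra.Structures using (IsGroup)

-- A (left) quasifield whose underlying set is Fin q (i.e. a quasifield with
-- exactly q elements; any finite set with q elements is in bijection with Fin q).
record Quasifield (q : ℕ) : Set where
  infixl 6 _+_
  infixl 7 _·_
  field
    _+_ : Fin q → Fin q → Fin q
    _·_ : Fin q → Fin q → Fin q
    0#  : Fin q
    -_  : Fin q → Fin q
    1#  : Fin q
    +-isGroup : IsGroup _≡_ _+_ 0# -_
    1≢0       : ¬ (1# ≡ 0#)
    ·-closed  : ∀ a b → ¬ (a ≡ 0#) → ¬ (b ≡ 0#) → ¬ (a · b ≡ 0#)
    ·-identityˡ : ∀ x → ¬ (x ≡ 0#) → 1# · x ≡ x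
    ·-identityʳ : ∀ x → ¬ (x ≡ 0#) → x · 1# ≡ x
    ·-leftDiv  : ∀ a b → ¬ (a ≡ 0#) → ¬ (b ≡ 0#) →
                 ∃! _≡_ (λ x → ¬ (x ≡ 0#) × a · x ≡ b)
    ·-rightDiv : ∀ a b → ¬ (a ≡ 0#) → ¬ (b ≡ 0#) →
                 ∃! _≡_ (λ y → ¬ (y ≡ 0#) × y · a ≡ b)
    distribˡ : ∀ a b c → a · (b + c) ≡ a · b + a · c
    zeroˡ : ∀ x → 0# · x ≡ 0#
    uniqueSol : ∀ a b c → ¬ (a ≡ b) → ∃! _≡_ (λ x → a · x ≡ b · x + c)

{-# OPTIONS --safe #-}
module Submission where

-- Fix z. Call the pairs (d , a) points and the pairs (c , b) lines, the point lying on the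
-- line iff a + b + c · d = z. A line has exactly q points, one for each d, and by the
-- quasifield axiom two distinct lines share at most one point. Let P = D × A, L = C × B, and
-- suppose no point of P lies on a line of L. The number of lines of L through a point is then
-- supported on the q² − |P| points outside P; these numbers sum to |L| q and their squares to
-- at most |L| q + |L|², since distinct lines meet at most once. Cauchy–Schwarz gives
-- (|L| q)² ≤ (q² − |P|)(|L| q + |L|²), which rearranges to |P| |L| ≤ q³.

open import Defs
open import Data.Nat using (ℕ; _^_; _<_) renaming (_*_ to _*ℕ_)
open import Data.Fin using (Fin)
open import Data.Fin.Subset using (Subset; _∈_; ∣_∣)
open import Data.Product using (∃-syntax; _×_)
open import Relation.Binary.PropositionalEquality using (_≡_)

open import Level using (0ℓ)
open import Algebra.Bundles using (Group)
import Algebra.Properties.Group as GroupProperties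
open import Data.Bool.Base using (if_then_else_)
open import Data.Fin.Base using (zero; suc; _↑ˡ_; _↑ʳ_; combine; remQuot)
open import Data.Fin.Properties using (_≟_; 0≢1+n; suc-injective; remQuot-combine; combine-remQuot; any?)
open import Data.Fin.Subset using (inside; outside)
open import Data.Fin.Subset.Properties using (_∈?_)
open import Data.Nat.Base using (zero; suc; _+_; _*_; _≤_; z≤n)
open import Data.Nat.Properties
  using ( ≤-refl; ≤-reflexive; ≤-trans; ≤-total; <⇒≱; m≤m+n; m≤n+m; m≤n⇒∃[o]m+o≡n
        ; +-comm; +-assoc; +-identityʳ; +-mono-≤; +-monoʳ-≤; +-cancelʳ-≤
        ; *-comm; *-assoc; *-identityˡ; *-identityʳ; *-zeroʳ; *-distribʳ-+
        ; *-monoˡ-≤; *-monoʳ-≤; *-cancelˡ-≤; +-*-semiring; module ≤-Reasoning )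
open import Algebra.Properties.Semiring.Sum +-*-semiring
  using (sum; sum-syntax; ∑-comm; ∑-distrib-+; *-distribˡ-sum; *-distribʳ-sum; sum-cong-≗; sum-replicate-zero)
open import Data.Nat.Tactic.RingSolver using (solve-∀)
open import Data.Product using (_,_; proj₁; proj₂; uncurry)
open import Data.Sum using ([_,_]′)
open import Data.Vec.Base using ([]; _∷_)
open import Function.Base using (_∘′_)
open import Relation.Binary.PropositionalEquality
open import Relation.Nullary using (Dec; yes; no; does; ¬_; ¬?; _×-dec_; contradiction)
open import Relation.Unary using (Pred; Decidable)

-- Defined through does, so that 𝟙 (suc i ≟ suc j) and 𝟙 (suc i ∈? s ∷ p)
-- reduce to 𝟙 (i ≟ j) and 𝟙 (i ∈? p).
𝟙 : {P : Set} → Dec P → ℕ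
𝟙 P? = if does P? then 1 else 0

module _ {P : Set} where

  𝟙-no : (P? : Dec P) → ¬ P → 𝟙 P? ≡ 0
  𝟙-no (yes p) ¬p = contradiction p ¬p
  𝟙-no (no _)  _  = refl

  𝟙≤1 : (P? : Dec P) → 𝟙 P? ≤ 1
  𝟙≤1 (yes _) = ≤-refl
  𝟙≤1 (no _)  = z≤n

  𝟙-idem : (P? : Dec P) → 𝟙 P? * 𝟙 P? ≡ 𝟙 P?
  𝟙-idem (yes _) = refl
  𝟙-idem (no _)  = refl

  𝟙-¬ : (P? : Dec P) → 𝟙 (¬? P?) + 𝟙 P? ≡ 1
  𝟙-¬ (yes _) = refl
  𝟙-¬ (no _)  = refl

  𝟙-× : {Q : Set} (P? : Dec P) (Q? : Dec Q) → 𝟙 (P? ×-dec Q?) ≡ 𝟙 P? * 𝟙 Q?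
  𝟙-× (yes _) Q? = sym (+-identityʳ (𝟙 Q?))
  𝟙-× (no _)  Q? = refl

  𝟙-cong : {Q : Set} (P? : Dec P) (Q? : Dec Q) → (P → Q) → (Q → P) → 𝟙 P? ≡ 𝟙 Q?
  𝟙-cong (yes p) (yes q) _ _ = refl
  𝟙-cong (yes p) (no ¬q) f _ = contradiction (f p) ¬q
  𝟙-cong (no ¬p) (yes q) _ g = contradiction (g q) ¬p
  𝟙-cong (no ¬p) (no ¬q) _ _ = refl

count : ∀ {n} {P : Pred (Fin n) 0ℓ} → Decidable P → ℕ
count {n} P? = ∑[ i < n ] 𝟙 (P? i)

∑-mono-≤ : ∀ {n} {f g : Fin n → ℕ} → (∀ i → f i ≤ g i) → sum f ≤ sum g
∑-mono-≤ {zero}  f≤g = z≤n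
∑-mono-≤ {suc n} f≤g = +-mono-≤ (f≤g zero) (∑-mono-≤ (λ i → f≤g (suc i)))

∑-zero : ∀ {n} {f : Fin n → ℕ} → (∀ i → f i ≡ 0) → sum f ≡ 0
∑-zero {n} f≡0 = trans (sum-cong-≗ f≡0) (sum-replicate-zero n)

∑-one : ∀ n → ∑[ i < n ] 1 ≡ n
∑-one zero    = refl
∑-one (suc n) = cong suc (∑-one n)

∑-*-∑ : ∀ {m n} (f : Fin m → ℕ) (g : Fin n → ℕ) →
        sum f * sum g ≡ ∑[ i < m ] ∑[ j < n ] (f i * g j)
∑-*-∑ f g = trans (*-distribʳ-sum (sum g) f) (sum-cong-≗ λ i → *-distribˡ-sum (f i) g)

∑-δ : ∀ {n} (i : Fin n) (f : Fin n → ℕ) → ∑[ j < n ] (𝟙 (j ≟ i) * f j) ≡ f i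
∑-δ {suc n} zero    f =
  trans (cong₂ _+_ (+-identityʳ (f zero)) (sum-replicate-zero n)) (+-identityʳ (f zero))
∑-δ {suc n} (suc i) f = ∑-δ i (λ j → f (suc j))

count-singleton : ∀ {n} (i : Fin n) → count (_≟ i) ≡ 1
count-singleton i = trans (sum-cong-≗ λ j → sym (*-identityʳ (𝟙 (j ≟ i)))) (∑-δ i (λ _ → 1))

count-¬ : ∀ {n} {P : Pred (Fin n) 0ℓ} (P? : Decidable P) → count (λ i → ¬? (P? i)) + count P? ≡ n
count-¬ {n} P? = begin
  count (λ i → ¬? (P? i)) + count P?     ≡⟨ ∑-distrib-+ (λ i → 𝟙 (¬? (P? i))) (λ i → 𝟙 (P? i)) ⟨
  ∑[ i < n ] (𝟙 (¬? (P? i)) + 𝟙 (P? i))  ≡⟨ sum-cong-≗ (λ i → 𝟙-¬ (P? i)) ⟩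
  ∑[ i < n ] 1                           ≡⟨ ∑-one n ⟩
  n                                      ∎
  where open ≡-Reasoning

count-≤1 : ∀ {n} {P : Pred (Fin n) 0ℓ} (P? : Decidable P) →
           (∀ {i j} → P i → P j → i ≡ j) → count P? ≤ 1
count-≤1 {zero}  P? unique = z≤n
count-≤1 {suc n} P? unique with P? zero
... | yes p₀ = ≤-reflexive (cong suc (∑-zero λ i → 𝟙-no (P? (suc i)) λ pᵢ → 0≢1+n (unique p₀ pᵢ)))
... | no _   = count-≤1 (λ i → P? (suc i)) λ pᵢ pⱼ → suc-injective (unique pᵢ pⱼ)

∣p∣≡count : ∀ {n} (p : Subset n) → ∣ p ∣ ≡ count (_∈? p)
∣p∣≡count []            = refl
∣p∣≡count (inside  ∷ p) = cong suc (∣p∣≡count p)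
∣p∣≡count (outside ∷ p) = ∣p∣≡count p

∑-splitAt : ∀ m {n} (f : Fin (m + n) → ℕ) → sum f ≡ ∑[ i < m ] f (i ↑ˡ n) + ∑[ j < n ] f (m ↑ʳ j)
∑-splitAt zero    f = refl
∑-splitAt (suc m) f =
  trans (cong (f zero +_) (∑-splitAt m (λ i → f (suc i)))) (sym (+-assoc (f zero) _ _))

∑-combine : ∀ m {n} (f : Fin (m * n) → ℕ) → sum f ≡ ∑[ i < m ] ∑[ j < n ] f (combine i j)
∑-combine zero        f = refl
∑-combine (suc m) {n} f =
  trans (∑-splitAt n f) (cong (∑[ j < n ] f (j ↑ˡ m * n) +_) (∑-combine m (λ k → f (n ↑ʳ k))))

∑-remQuot : ∀ {m} n (g : Fin m × Fin n → ℕ) →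
            ∑[ k < m * n ] g (remQuot n k) ≡ ∑[ i < m ] ∑[ j < n ] g (i , j)
∑-remQuot {m} n g =
  trans (∑-combine m _) (sum-cong-≗ λ i → sum-cong-≗ λ j → cong g (remQuot-combine i j))

remQuot-injective : ∀ {m} n {i j : Fin (m * n)} → remQuot {m} n i ≡ remQuot n j → i ≡ j
remQuot-injective {m} n {i} {j} eq =
  trans (sym (combine-remQuot {m} n i)) (trans (cong (uncurry combine) eq) (combine-remQuot {m} n j))

Box : ∀ {m} n → Pred (Fin m) 0ℓ → Pred (Fin n) 0ℓ → Pred (Fin (m * n)) 0ℓ
Box {m} n P Q k = P (proj₁ (remQuot {m} n k)) × Q (proj₂ (remQuot {m} n k))

box? : ∀ {m n} {P : Pred (Fin m) 0ℓ} {Q : Pred (Fin n) 0ℓ} →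
       Decidable P → Decidable Q → Decidable (Box n P Q)
box? {m} {n} P? Q? k = P? (proj₁ (remQuot {m} n k)) ×-dec Q? (proj₂ (remQuot {m} n k))

count-box : ∀ {m n} {P : Pred (Fin m) 0ℓ} {Q : Pred (Fin n) 0ℓ} (P? : Decidable P) (Q? : Decidable Q) →
            count (box? P? Q?) ≡ count P? * count Q?
count-box {m} {n} P? Q? = begin
  ∑[ k < m * n ] 𝟙 (box? P? Q? k)
    ≡⟨ ∑-remQuot n (λ (i , j) → 𝟙 (P? i ×-dec Q? j)) ⟩
  ∑[ i < m ] ∑[ j < n ] 𝟙 (P? i ×-dec Q? j)
    ≡⟨ sum-cong-≗ (λ i → sum-cong-≗ λ j → 𝟙-× (P? i) (Q? j)) ⟩
  ∑[ i < m ] ∑[ j < n ] (𝟙 (P? i) * 𝟙 (Q? j))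
    ≡⟨ ∑-*-∑ (λ i → 𝟙 (P? i)) (λ j → 𝟙 (Q? j)) ⟨
  count P? * count Q?
    ∎
  where open ≡-Reasoning

2xy≤x²+y² : ∀ x y → 2 * (x * y) ≤ x * x + y * y
2xy≤x²+y² x y = [ ordered , swapped ]′ (≤-total x y)
  where
  ordered : ∀ {x y} → x ≤ y → 2 * (x * y) ≤ x * x + y * y
  ordered {x} x≤y with m≤n⇒∃[o]m+o≡n x≤y
  ... | t , refl = subst (2 * (x * (x + t)) ≤_) (square-gap x t) (m≤m+n _ (t * t))
    where
    square-gap : ∀ x t → 2 * (x * (x + t)) + t * t ≡ x * x + (x + t) * (x + t)
    square-gap = solve-∀
  swapped : y ≤ x → 2 * (x * y) ≤ x * x + y * y
  swapped y≤x = subst₂ _≤_ (cong (2 *_) (*-comm y x)) (+-comm (y * y) (x * x)) (ordered y≤x)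

cauchy-schwarz : ∀ {n} (u x : Fin n → ℕ) →
  (∑[ i < n ] (u i * x i)) * (∑[ i < n ] (u i * x i)) ≤ sum u * ∑[ i < n ] (u i * (x i * x i))
cauchy-schwarz {n} u x = *-cancelˡ-≤ 2 (begin
  2 * (sum ux * sum ux)
    ≡⟨ cong (2 *_) (∑-*-∑ ux ux) ⟩
  2 * ∑[ i < n ] ∑[ j < n ] (ux i * ux j)
    ≡⟨ trans (*-distribˡ-sum {n} 2 _) (sum-cong-≗ {n} λ i → *-distribˡ-sum {n} 2 _) ⟩
  ∑[ i < n ] ∑[ j < n ] (2 * (ux i * ux j))
    ≤⟨ ∑-mono-≤ (λ i → ∑-mono-≤ λ j → weighted-am-gm (u i) (u j) (x i) (x j)) ⟩
  ∑[ i < n ] ∑[ j < n ] (u i * uxx j + uxx i * u j)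
    ≡⟨ sum-cong-≗ (λ i → ∑-distrib-+ (λ j → u i * uxx j) (λ j → uxx i * u j)) ⟩
  ∑[ i < n ] (∑[ j < n ] (u i * uxx j) + ∑[ j < n ] (uxx i * u j))
    ≡⟨ ∑-distrib-+ {n} _ _ ⟩
  ∑[ i < n ] ∑[ j < n ] (u i * uxx j) + ∑[ i < n ] ∑[ j < n ] (uxx i * u j)
    ≡⟨ cong₂ _+_ (∑-*-∑ u uxx) (∑-*-∑ uxx u) ⟨
  sum u * sum uxx + sum uxx * sum u
    ≡⟨ cong (sum u * sum uxx +_) (trans (*-comm (sum uxx) (sum u)) (sym (+-identityʳ _))) ⟩
  2 * (sum u * sum uxx)
    ∎)
  where
  open ≤-Reasoning
  ux uxx : Fin n → ℕ
  ux i = u i * x i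
  uxx i = u i * (x i * x i)
  weighted-am-gm : ∀ a b x y → 2 * ((a * x) * (b * y)) ≤ a * (b * (y * y)) + (a * (x * x)) * b
  weighted-am-gm a b x y = subst₂ _≤_ (lhs a b x y) (rhs a b x y) (*-monoʳ-≤ (a * b) (2xy≤x²+y² x y))
    where
    lhs : ∀ a b x y → (a * b) * (2 * (x * y)) ≡ 2 * ((a * x) * (b * y))
    lhs = solve-∀
    rhs : ∀ a b x y → (a * b) * (x * x + y * y) ≡ a * (b * (y * y)) + (a * (x * x)) * b
    rhs = solve-∀

product≤cube : ∀ k N M L → N + M ≡ k * k → (L * k) * (L * k) ≤ N * (L * k + L * L) → M * L ≤ k ^ 3
product≤cube k N M zero      _       _     = ≤-trans (≤-reflexive (*-zeroʳ M)) z≤n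
product≤cube k N M L@(suc _) N+M≡k² bound = begin
  M * L                          ≤⟨ *-monoʳ-≤ M (m≤n+m L k) ⟩
  M * (k + L)                    ≤⟨ +-cancelʳ-≤ (L * (k * k)) _ _ (begin
    M * (k + L) + L * (k * k)      ≤⟨ +-monoʳ-≤ (M * (k + L)) Lk²≤N[k+L] ⟩
    M * (k + L) + N * (k + L)      ≡⟨ +-comm (M * (k + L)) _ ⟩
    N * (k + L) + M * (k + L)      ≡⟨ *-distribʳ-+ (k + L) N M ⟨
    (N + M) * (k + L)              ≡⟨ cong (_* (k + L)) N+M≡k² ⟩
    (k * k) * (k + L)              ≡⟨ expand k L ⟩
    k ^ 3 + L * (k * k)            ∎) ⟩
  k ^ 3                          ∎
  where
  open ≤-Reasoning
  expand : ∀ k L → (k * k) * (k + L) ≡ k * (k * (k * 1)) + L * (k * k)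
  expand = solve-∀
  factorˡ : ∀ k L → (L * k) * (L * k) ≡ L * (L * (k * k))
  factorˡ = solve-∀
  factorʳ : ∀ k L N → N * (L * k + L * L) ≡ L * (N * (k + L))
  factorʳ = solve-∀
  Lk²≤N[k+L] : L * (k * k) ≤ N * (k + L)
  Lk²≤N[k+L] = *-cancelˡ-≤ L (subst₂ _≤_ (factorˡ k L) (factorʳ k L N) bound)

module PointLineIncidence
  {n m k : ℕ} (_I_ : Fin n → Fin m → Set) (_I?_ : ∀ p l → Dec (p I l))
  (points-on-line : ∀ l → count (_I? l) ≡ k)
  (lines-meet-once : ∀ {l l' p p'} → l ≢ l' → p I l → p I l' → p' I l → p' I l' → p ≡ p')
  where

  common-points≤ : ∀ l l' → ∑[ p < n ] (𝟙 (p I? l) * 𝟙 (p I? l')) ≤ 𝟙 (l' ≟ l) * k + 1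
  common-points≤ l l' with l' ≟ l
  ... | yes refl = begin
    ∑[ p < n ] (𝟙 (p I? l) * 𝟙 (p I? l))   ≡⟨ sum-cong-≗ {n} (λ p → 𝟙-idem (p I? l)) ⟩
    count (_I? l)                          ≡⟨ trans (points-on-line l) (sym (*-identityˡ k)) ⟩
    1 * k                                  ≤⟨ m≤m+n (1 * k) 1 ⟩
    1 * k + 1                              ∎
    where open ≤-Reasoning
  ... | no l'≢l = begin
    ∑[ p < n ] (𝟙 (p I? l) * 𝟙 (p I? l'))  ≡⟨ sum-cong-≗ {n} (λ p → 𝟙-× (p I? l) (p I? l')) ⟨
    count (λ p → p I? l ×-dec p I? l')     ≤⟨ count-≤1 (λ p → p I? l ×-dec p I? l') on-both-once ⟩
    1                                      ∎
    where
    open ≤-Reasoning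
    on-both-once : ∀ {p p'} → p I l × p I l' → p' I l × p' I l' → p ≡ p'
    on-both-once (pl , pl') (p'l , p'l') = lines-meet-once (l'≢l ∘′ sym) pl pl' p'l p'l'

  module _ {L : Pred (Fin m) 0ℓ} (L? : Decidable L) where

    degree : Fin n → ℕ
    degree p = ∑[ l < m ] (𝟙 (L? l) * 𝟙 (p I? l))

    ∑-degree : ∑[ p < n ] degree p ≡ count L? * k
    ∑-degree = begin
      ∑[ p < n ] ∑[ l < m ] (𝟙 (L? l) * 𝟙 (p I? l))
        ≡⟨ ∑-comm (λ p l → 𝟙 (L? l) * 𝟙 (p I? l)) ⟩
      ∑[ l < m ] ∑[ p < n ] (𝟙 (L? l) * 𝟙 (p I? l))
        ≡⟨ sum-cong-≗ {m} (λ l → *-distribˡ-sum (𝟙 (L? l)) (λ p → 𝟙 (p I? l))) ⟨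
      ∑[ l < m ] (𝟙 (L? l) * count (_I? l))
        ≡⟨ sum-cong-≗ {m} (λ l → cong (𝟙 (L? l) *_) (points-on-line l)) ⟩
      ∑[ l < m ] (𝟙 (L? l) * k)
        ≡⟨ *-distribʳ-sum k (λ l → 𝟙 (L? l)) ⟨
      count L? * k
        ∎
      where open ≡-Reasoning

    ∑-degree²-by-line-pairs :
      ∑[ p < n ] (degree p * degree p) ≡
      ∑[ l < m ] ∑[ l' < m ] ((𝟙 (L? l) * 𝟙 (L? l')) * ∑[ p < n ] (𝟙 (p I? l) * 𝟙 (p I? l')))
    ∑-degree²-by-line-pairs = begin
      ∑[ p < n ] (degree p * degree p)
        ≡⟨ sum-cong-≗ {n} (λ p → ∑-*-∑ (wι p) (wι p)) ⟩
      ∑[ p < n ] ∑[ l < m ] ∑[ l' < m ] (wι p l * wι p l')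
        ≡⟨ ∑-comm (λ p l → ∑[ l' < m ] (wι p l * wι p l')) ⟩
      ∑[ l < m ] ∑[ p < n ] ∑[ l' < m ] (wι p l * wι p l')
        ≡⟨ sum-cong-≗ {m} (λ l → ∑-comm (λ p l' → wι p l * wι p l')) ⟩
      ∑[ l < m ] ∑[ l' < m ] ∑[ p < n ] (wι p l * wι p l')
        ≡⟨ sum-cong-≗ {m} (λ l → sum-cong-≗ {m} λ l' → factor-weights l l') ⟩
      ∑[ l < m ] ∑[ l' < m ] ((𝟙 (L? l) * 𝟙 (L? l')) * ∑[ p < n ] (𝟙 (p I? l) * 𝟙 (p I? l')))
        ∎
      where
      open ≡-Reasoning
      wι : Fin n → Fin m → ℕ
      wι p l = 𝟙 (L? l) * 𝟙 (p I? l)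
      interchange : ∀ a b x y → (a * x) * (b * y) ≡ (a * b) * (x * y)
      interchange = solve-∀
      factor-weights : ∀ l l' → ∑[ p < n ] (wι p l * wι p l') ≡
                                (𝟙 (L? l) * 𝟙 (L? l')) * ∑[ p < n ] (𝟙 (p I? l) * 𝟙 (p I? l'))
      factor-weights l l' =
        trans (sum-cong-≗ {n} λ p → interchange (𝟙 (L? l)) (𝟙 (L? l')) (𝟙 (p I? l)) (𝟙 (p I? l')))
              (sym (*-distribˡ-sum (𝟙 (L? l) * 𝟙 (L? l')) (λ p → 𝟙 (p I? l) * 𝟙 (p I? l'))))

    ∑-pair-weights : ∑[ l < m ] ∑[ l' < m ] ((𝟙 (L? l) * 𝟙 (L? l')) * (𝟙 (l' ≟ l) * k + 1)) ≡
                     count L? * k + count L? * count L?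
    ∑-pair-weights = begin
      ∑[ l < m ] ∑[ l' < m ] ((w l * w l') * (𝟙 (l' ≟ l) * k + 1))
        ≡⟨ sum-cong-≗ {m} (λ l → sum-cong-≗ {m} λ l' → split (w l) (w l') (𝟙 (l' ≟ l)) k) ⟩
      ∑[ l < m ] ∑[ l' < m ] (𝟙 (l' ≟ l) * (w l' * (w l * k)) + w l * w l')
        ≡⟨ sum-cong-≗ {m} (λ l → ∑-distrib-+ (λ l' → 𝟙 (l' ≟ l) * (w l' * (w l * k))) ((w l *_) ∘′ w)) ⟩
      ∑[ l < m ] (∑[ l' < m ] (𝟙 (l' ≟ l) * (w l' * (w l * k))) + ∑[ l' < m ] (w l * w l'))
        ≡⟨ sum-cong-≗ {m} (λ l → cong₂ _+_ (∑-δ l (λ l' → w l' * (w l * k)))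
                                           (sym (*-distribˡ-sum (w l) w))) ⟩
      ∑[ l < m ] (w l * (w l * k) + w l * count L?)
        ≡⟨ sum-cong-≗ {m} (λ l → cong (_+ w l * count L?) (w²k≡wk l)) ⟩
      ∑[ l < m ] (w l * k + w l * count L?)
        ≡⟨ ∑-distrib-+ (λ l → w l * k) (λ l → w l * count L?) ⟩
      ∑[ l < m ] (w l * k) + ∑[ l < m ] (w l * count L?)
        ≡⟨ cong₂ _+_ (*-distribʳ-sum k w) (*-distribʳ-sum (count L?) w) ⟨
      count L? * k + count L? * count L?
        ∎
      where
      open ≡-Reasoning
      w : Fin m → ℕ
      w l = 𝟙 (L? l)
      split : ∀ a b δ k → (a * b) * (δ * k + 1) ≡ δ * (b * (a * k)) + a * b
      split = solve-∀
      w²k≡wk : ∀ l → w l * (w l * k) ≡ w l * k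
      w²k≡wk l = trans (sym (*-assoc (w l) (w l) k)) (cong (_* k) (𝟙-idem (L? l)))

    ∑-degree² : ∑[ p < n ] (degree p * degree p) ≤ count L? * k + count L? * count L?
    ∑-degree² = begin
      ∑[ p < n ] (degree p * degree p)
        ≡⟨ ∑-degree²-by-line-pairs ⟩
      ∑[ l < m ] ∑[ l' < m ] ((𝟙 (L? l) * 𝟙 (L? l')) * ∑[ p < n ] (𝟙 (p I? l) * 𝟙 (p I? l')))
        ≤⟨ ∑-mono-≤ (λ l → ∑-mono-≤ λ l' →
             *-monoʳ-≤ (𝟙 (L? l) * 𝟙 (L? l')) (common-points≤ l l')) ⟩
      ∑[ l < m ] ∑[ l' < m ] ((𝟙 (L? l) * 𝟙 (L? l')) * (𝟙 (l' ≟ l) * k + 1))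
        ≡⟨ ∑-pair-weights ⟩
      count L? * k + count L? * count L?
        ∎
      where open ≤-Reasoning

    module _ {P : Pred (Fin n) 0ℓ} (P? : Decidable P) (disjoint : ∀ {p l} → P p → L l → ¬ p I l) where

      degree-vanishes-on-P : ∀ {p} → P p → degree p ≡ 0
      degree-vanishes-on-P {p} pP = ∑-zero no-line-through-p
        where
        no-line-through-p : ∀ l → 𝟙 (L? l) * 𝟙 (p I? l) ≡ 0
        no-line-through-p l with L? l
        ... | yes lL = trans (*-identityˡ _) (𝟙-no (p I? l) (disjoint pP lL))
        ... | no _   = refl

      degree-supported-off-P : ∀ p → 𝟙 (¬? (P? p)) * degree p ≡ degree p
      degree-supported-off-P p with P? p
      ... | yes pP = sym (degree-vanishes-on-P pP)
      ... | no _   = *-identityˡ (degree p)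

      incidence-free-bound :
        (count L? * k) * (count L? * k) ≤ count (λ p → ¬? (P? p)) * (count L? * k + count L? * count L?)
      incidence-free-bound = begin
        (count L? * k) * (count L? * k)
          ≡⟨ cong (λ s → s * s) ∑-degree-off-P ⟨
        (∑[ p < n ] (u p * degree p)) * (∑[ p < n ] (u p * degree p))
          ≤⟨ cauchy-schwarz u degree ⟩
        sum u * ∑[ p < n ] (u p * (degree p * degree p))
          ≤⟨ *-monoʳ-≤ (sum u) (∑-mono-≤ λ p → weight≤1 p (degree p * degree p)) ⟩
        sum u * ∑[ p < n ] (degree p * degree p)
          ≤⟨ *-monoʳ-≤ (sum u) ∑-degree² ⟩
        sum u * (count L? * k + count L? * count L?)
          ∎
        where
        open ≤-Reasoning
        u : Fin n → ℕ
        u p = 𝟙 (¬? (P? p))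
        ∑-degree-off-P : ∑[ p < n ] (u p * degree p) ≡ count L? * k
        ∑-degree-off-P = trans (sum-cong-≗ {n} degree-supported-off-P) ∑-degree
        weight≤1 : ∀ p x → u p * x ≤ x
        weight≤1 p x = ≤-trans (*-monoˡ-≤ x (𝟙≤1 (¬? (P? p)))) (≤-reflexive (*-identityˡ x))

module QuasifieldLines {q : ℕ} (Q : Quasifield q) where

  open Quasifield Q renaming (_+_ to _⊕_)

  +-group : Group 0ℓ 0ℓ
  +-group = record { isGroup = +-isGroup }

  open GroupProperties +-group
  open Group +-group using (_//_; assoc; inverseˡ; identityʳ)

  ·-zeroʳ : ∀ c → c · 0# ≡ 0#
  ·-zeroʳ c = identityʳ-unique (c · 0#) (c · 0#)
                (trans (sym (distribˡ c 0# 0#)) (cong (c ·_) (identityʳ 0#)))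

  ·-negʳ : ∀ c d → c · (- d) ≡ - (c · d)
  ·-negʳ c d = inverseˡ-unique (c · (- d)) (c · d)
                 (trans (sym (distribˡ c (- d) d)) (trans (cong (c ·_) (inverseˡ d)) (·-zeroʳ c)))

  solve-left : ∀ {a b x z} → (a ⊕ b) ⊕ x ≡ z → a ≡ (z // x) // b
  solve-left {a} {b} {x} {z} eq = x≈z//y a b (z // x) (x≈z//y (a ⊕ b) x z eq)

  unsolve-left : ∀ {a b x z} → a ≡ (z // x) // b → (a ⊕ b) ⊕ x ≡ z
  unsolve-left {b = b} {x} {z} refl =
    trans (cong (_⊕ x) (//-rightDividesˡ b (z // x))) (//-rightDividesˡ x z)

  module Lines (z : Fin q) where

    OnLine : Fin q × Fin q → Fin q × Fin q → Set
    OnLine (d , a) (c , b) = (a ⊕ b) ⊕ c · d ≡ z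

    OnLine? : ∀ x ℓ → Dec (OnLine x ℓ)
    OnLine? (d , a) (c , b) = (a ⊕ b) ⊕ c · d ≟ z

    one-point-per-abscissa : ∀ ℓ d → ∑[ a < q ] 𝟙 (OnLine? (d , a) ℓ) ≡ 1
    one-point-per-abscissa (c , b) d =
      trans (sum-cong-≗ λ a → 𝟙-cong (OnLine? (d , a) (c , b)) (a ≟ (z // (c · d)) // b) solve-left unsolve-left)
            (count-singleton ((z // (c · d)) // b))

    shared-point : ∀ {c b c' b' d a} → OnLine (d , a) (c , b) → OnLine (d , a) (c' , b') →
                   b ⊕ c · d ≡ b' ⊕ c' · d
    shared-point {c} {b} {c'} {b'} {d} {a} on on' =
      ∙-cancelˡ a _ _ (trans (sym (assoc a b (c · d))) (trans on (trans (sym on') (assoc a b' (c' · d)))))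

    -- uniqueSol needs the translation on the right of c' · x, while a shared point puts it on
    -- the left; since addition need not commute, pass to x = - d.
    shared-point⇒offset : ∀ {c b c' b' d} → b ⊕ c · d ≡ b' ⊕ c' · d →
                          c · (- d) ≡ c' · (- d) ⊕ (- b' ⊕ b)
    shared-point⇒offset {c} {b} {c'} {b'} {d} eq = begin
      c · (- d)                  ≡⟨ ·-negʳ c d ⟩
      - (c · d)                  ≡⟨ //-rightDividesˡ b (- (c · d)) ⟨
      (- (c · d) ⊕ - b) ⊕ b      ≡⟨ cong (_⊕ b) (⁻¹-anti-homo-∙ b (c · d)) ⟨
      - (b ⊕ c · d) ⊕ b          ≡⟨ cong (λ y → - y ⊕ b) eq ⟩
      - (b' ⊕ c' · d) ⊕ b        ≡⟨ cong (_⊕ b) (⁻¹-anti-homo-∙ b' (c' · d)) ⟩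
      (- (c' · d) ⊕ - b') ⊕ b    ≡⟨ assoc (- (c' · d)) (- b') b ⟩
      - (c' · d) ⊕ (- b' ⊕ b)    ≡⟨ cong (_⊕ (- b' ⊕ b)) (·-negʳ c' d) ⟨
      c' · (- d) ⊕ (- b' ⊕ b)    ∎
      where open ≡-Reasoning

    lines-meet-once : ∀ {ℓ ℓ' x x'} → ℓ ≢ ℓ' →
                      OnLine x ℓ → OnLine x ℓ' → OnLine x' ℓ → OnLine x' ℓ' → x ≡ x'
    lines-meet-once {c , b} {c' , b'} {d , a} {d' , a'} ℓ≢ℓ' xℓ xℓ' x'ℓ x'ℓ' = cong₂ _,_ d≡d' a≡a'
      where
      d≡d' : d ≡ d'
      d≡d' with c ≟ c'
      ... | yes refl = contradiction (cong (c ,_) (∙-cancelʳ (c · d) b b' (shared-point xℓ xℓ'))) ℓ≢ℓ'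
      ... | no c≢c' with uniqueSol c c' (- b' ⊕ b) c≢c'
      ...   | _ , _ , unique = ⁻¹-injective (trans (sym (unique (shared-point⇒offset (shared-point xℓ xℓ'))))
                                                    (unique (shared-point⇒offset (shared-point x'ℓ x'ℓ'))))
      a≡a' : a ≡ a'
      a≡a' = trans (solve-left xℓ) (trans (cong (λ e → (z // (c · e)) // b) d≡d') (sym (solve-left x'ℓ)))

    -- Points and lines are coded in Fin (q * q) through remQuot, so that sums over them are sums over Fin.
    _I_ : Fin (q * q) → Fin (q * q) → Set
    p I l = OnLine (remQuot q p) (remQuot q l)

    _I?_ : ∀ p l → Dec (p I l)
    p I? l = OnLine? (remQuot q p) (remQuot q l)

    points-on-line : ∀ l → count (_I? l) ≡ q
    points-on-line l = begin
      ∑[ p < q * q ] 𝟙 (OnLine? (remQuot q p) ℓ)   ≡⟨ ∑-remQuot q (λ x → 𝟙 (OnLine? x ℓ)) ⟩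
      ∑[ d < q ] ∑[ a < q ] 𝟙 (OnLine? (d , a) ℓ)  ≡⟨ sum-cong-≗ {q} (one-point-per-abscissa ℓ) ⟩
      ∑[ d < q ] 1                                 ≡⟨ ∑-one q ⟩
      q                                            ∎
      where
      open ≡-Reasoning
      ℓ = remQuot q l

    open PointLineIncidence _I_ _I?_ points-on-line
      (λ l≢l' pl pl' p'l p'l' →
        remQuot-injective q (lines-meet-once (l≢l' ∘′ remQuot-injective q) pl pl' p'l p'l'))
      public

module Sumset {q : ℕ} (Q : Quasifield q) (z : Fin q) (A B C D : Subset q) where

  open QuasifieldLines.Lines Q z

  Incidence : Set
  Incidence = ∃[ p ] ∃[ l ] (Box q (_∈ D) (_∈ A) p × Box q (_∈ C) (_∈ B) l × p I l)

  incidence? : Dec Incidence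
  incidence? = any? λ p → any? λ l → box? (_∈? D) (_∈? A) p ×-dec box? (_∈? C) (_∈? B) l ×-dec p I? l

  no-incidence⇒≤q³ : ¬ Incidence → ∣ A ∣ * ∣ B ∣ * ∣ C ∣ * ∣ D ∣ ≤ q ^ 3
  no-incidence⇒≤q³ none = begin
    ∣ A ∣ * ∣ B ∣ * ∣ C ∣ * ∣ D ∣       ≡⟨ regroup (∣ A ∣) (∣ B ∣) (∣ C ∣) (∣ D ∣) ⟩
    (∣ D ∣ * ∣ A ∣) * (∣ C ∣ * ∣ B ∣)   ≡⟨ cong₂ _*_ (size-box D A) (size-box C B) ⟩
    count P? * count L?                 ≤⟨ product≤cube q _ (count P?) (count L?) (count-¬ P?)
                                             (incidence-free-bound L? P? disjoint) ⟩
    q ^ 3                               ∎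
    where
    open ≤-Reasoning
    P? = box? (_∈? D) (_∈? A)
    L? = box? (_∈? C) (_∈? B)
    disjoint : ∀ {p l} → Box q (_∈ D) (_∈ A) p → Box q (_∈ C) (_∈ B) l → ¬ p I l
    disjoint {p} {l} p∈P l∈L p∈l = none (p , l , p∈P , l∈L , p∈l)
    size-box : ∀ S T → ∣ S ∣ * ∣ T ∣ ≡ count (box? {q} (_∈? S) (_∈? T))
    size-box S T = trans (cong₂ _*_ (∣p∣≡count S) (∣p∣≡count T)) (sym (count-box (_∈? S) (_∈? T)))
    regroup : ∀ a b c d → a * b * c * d ≡ (d * a) * (c * b)
    regroup = solve-∀

open Sumset using (incidence?; no-incidence⇒≤q³)

corollary1p10 : (q : ℕ) (Q : Quasifield q) (A B C D : Subset q) →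
    q ^ 3 < ∣ A ∣ *ℕ ∣ B ∣ *ℕ ∣ C ∣ *ℕ ∣ D ∣ →
    (z : Fin q) → ∃[ a ] ∃[ b ] ∃[ c ] ∃[ d ]
      (a ∈ A × b ∈ B × c ∈ C × d ∈ D ×
       z ≡ Quasifield._+_ Q (Quasifield._+_ Q a b) (Quasifield._·_ Q c d))
corollary1p10 q Q A B C D q³<∣A∣∣B∣∣C∣∣D∣ z with incidence? Q z A B C D
... | yes (_ , _ , (d∈D , a∈A) , (c∈C , b∈B) , on-line) = _ , _ , _ , _ , a∈A , b∈B , c∈C , d∈D , sym on-line
... | no none = contradiction (no-incidence⇒≤q³ Q z A B C D none) (<⇒≱ q³<∣A∣∣B∣∣C∣∣D∣)
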